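{- Every class of graphs that contains only finitely many graphs up to isomorphism has a right hom algorithm.
   Context: Graphs are finite, simple, undirected, with non-empty vertex set; classes are closed under isomorphism. $\hom(G,F)$ is the number of homomorphisms from $G$ to $F$. A class $\mathcal C$ has a right hom algorithm if there are $k\ge1$ and graphs $F_1,\dots,F_k$ such that for all graphs $G,H$: if $\hom(G,F_i)=\hom(H,F_i)$ for all $i\in[k]$, then ($G\in\mathcal C\iff H\in\mathcal C$). -}

module Defs where

open import Data.Nat using (ℕ; zero; suc; _≤_)
open import Data.Fin using (Fin; zero; suc)
open import Data.Bool using (Bool; true; false; _∨_; _∧_; not)
open import Data.List using (List; []; _∷_; [_]; map; concatMap; length; filterᵇ; allFin)
open import Data.Product using (Σ; ∃; _×_)
open import Data.List.Relation.Unary.Any using (Any)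
open import Function.Bundles using (_⇔_)
open import Relation.Binary.PropositionalEquality using (_≡_)

record Graph : Set where
  field
    order     : ℕ
    nonempty  : 1 ≤ order
    adj       : Fin order → Fin order → Bool
    adj-sym   : ∀ u v → adj u v ≡ adj v u
    adj-irrefl : ∀ u → adj u u ≡ false
open Graph public

record _≅_ (G H : Graph) : Set where
  field
    to      : Fin (order G) → Fin (order H)
    from    : Fin (order H) → Fin (order G)
    from-to : ∀ u → from (to u) ≡ u
    to-from : ∀ v → to (from v) ≡ v
    adj-pres : ∀ u v → adj H (to u) (to v) ≡ adj G u v

IsoClosed : (Graph → Set) → Set
IsoClosed C = ∀ {G H} → G ≅ H → C G → C H

allᵇ : ∀ {A : Set} → (A → Bool) → List A → Bool
allᵇ p []       = true
allᵇ p (x ∷ xs) = p x ∧ allᵇ p xs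

extend : ∀ {m n} → Fin n → (Fin m → Fin n) → (Fin (suc m) → Fin n)
extend j f zero    = j
extend j f (suc i) = f i

allFuns : ∀ m n → List (Fin m → Fin n)
allFuns zero    n = [ (λ ()) ]
allFuns (suc m) n = concatMap (λ f → map (λ j → extend j f) (allFin n)) (allFuns m n)

isHom : (G F : Graph) → (Fin (order G) → Fin (order F)) → Bool
isHom G F f = allᵇ (λ u → allᵇ (λ v → not (adj G u v) ∨ adj F (f u) (f v))
                                (allFin (order G)))
                   (allFin (order G))

hom : Graph → Graph → ℕ
hom G F = length (filterᵇ (isHom G F) (allFuns (order G) (order F)))

FinitelyManyUpToIso : (Graph → Set) → Set
FinitelyManyUpToIso C = Σ (List Graph) λ Ls → ∀ G → C G → Any (G ≅_) Ls

HasRightHomAlgorithm : (Graph → Set) → Set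
HasRightHomAlgorithm C =
  Σ ℕ λ k → (1 ≤ k) × Σ (Fin k → Graph) λ F →
    ∀ G H → (∀ i → hom G (F i) ≡ hom H (F i)) → (C G ⇔ C H)

-- Let s ≥ 1 bound the orders of the graphs in C, and test with all graphs on at most
-- B = (s+1)^s + (s+1) vertices.  Suppose G ∈ C and hom(G,F) = hom(H,F) for every test graph F.
-- G is s-colourable, i.e. hom(G,K_s) > 0, hence so is H; recolouring any one vertex of H
-- with a fresh colour gives |H| distinct (s+1)-colourings, so
-- |H| ≤ hom(H,K_{s+1}) = hom(G,K_{s+1}) ≤ (s+1)^s.
-- For targets F on at most B vertices, inclusion–exclusion over the vertices of F
-- expresses the number of surjective homomorphisms into F by hom counts into induced
-- subgraphs of F, so G and H have as many surjections onto G, and onto H, as each other.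
-- Hence there are surjective homomorphisms G → H and H → G; they are bijections, and
-- comparing edge counts shows that they reflect adjacency, so G ≅ H.

module Submission where

open import Defs

open import Data.Bool using (Bool; true; false; T; not; _∧_; _∨_)
open import Data.Bool.ListAction using (all; any; or)
open import Data.Empty using (⊥; ⊥-elim)
open import Data.Fin using (Fin; zero; suc; _≟_; punchIn; punchOut; inject≤; inject₁; fromℕ; fromℕ<)
open import Data.Fin.Properties
  using (any?; punchIn-injective; punchInᵢ≢i; punchIn-punchOut; inject≤-injective;
         inject₁-injective; fromℕ≢inject₁; injective⇒≤)
open import Data.List
  using (List; []; _∷_; map; concatMap; length; filterᵇ; allFin; lookup; cartesianProduct; upTo)
open import Data.List.Properties
  using (length-++; length-map; length-tabulate; length-removeAt′; length-filter;
         filter-all; filter-none; filter-≐; map-cong)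
open import Data.List.Membership.Propositional using (_∈_)
open import Data.List.Membership.Propositional.Properties
  using (∈-allFin; ∈-upTo⁺; ∈-filter⁺; ∈-cartesianProduct⁺)
open import Data.List.Relation.Unary.All as All using (All; []; _∷_)
import Data.List.Relation.Unary.All.Properties as Allₚ
open import Data.List.Relation.Unary.Any as Any using (Any; here; there; _─_)
import Data.List.Relation.Unary.Any.Properties as Anyₚ
open import Data.List.Relation.Unary.AllPairs as AllPairs using (AllPairs; []; _∷_)
import Data.List.Relation.Unary.AllPairs.Properties as AllPairsₚ
open import Data.List.Relation.Unary.Unique.Propositional using (Unique)
import Data.List.Relation.Unary.Unique.Propositional.Properties as Uniqueₚ
open import Data.Nat using (ℕ; zero; suc; _+_; _*_; _^_; _≤_; _<_; z≤n; s≤s; z<s; NonZero; _≤?_)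
open import Data.Nat.Base using (>-nonZero⁻¹; s≤s⁻¹)
open import Data.Nat.ListAction using (sum)
open import Data.Nat.Properties
  using (≤-trans; ≤-reflexive; ≤-antisym; +-suc; *-comm; +-cancelʳ-≡; <⇒≱; ≰⇒>;
         m≤m+n; m≤n+m; n≤1+n; n≮n; ^-monoʳ-≤; module ≤-Reasoning)
import Data.Product as Product
open import Data.Product using (∃; _×_; _,_; proj₁; proj₂)
open import Data.Sum using ([_,_]′)
open import Data.Unit using (⊤; tt)
open import Data.Vec.Functional using () renaming (_∷_ to _◂_)
open import Function using (_∘_; id)
open import Function.Bundles using (_⇔_; mk⇔; Equivalence)
open import Function.Definitions using (Injective)
open import Relation.Binary.PropositionalEquality
open import Relation.Nullary using (¬_; yes; no; contradiction)
open import Relation.Nullary.Decidable using (⌊_⌋; T?; toWitness; fromWitness)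

private
  variable
    A B : Set
    m n : ℕ

private
  Any-─ : {P Q : A → Set} {xs : List A} (p : Any P xs) →
          (∀ {x} → P x → Q x → ⊥) → Any Q xs → Any Q (xs ─ p)
  Any-─ (here px) P∩Q≡∅ (here qx) = ⊥-elim (P∩Q≡∅ px qx)
  Any-─ (here _)  _     (there q) = q
  Any-─ (there _) _     (here qx) = here qx
  Any-─ (there p) P∩Q≡∅ (there q) = there (Any-─ p P∩Q≡∅ q)

length-≤-injection :
  {D : A → A → Set} {R : A → B → Set} →
  (∀ {x x′ y} → D x x′ → R x y → R x′ y → ⊥) →
  {xs : List A} {ys : List B} →
  AllPairs D xs → All (λ x → Any (R x) ys) xs → length xs ≤ length ys
length-≤-injection R-injective [] [] = z≤n
length-≤-injection R-injective {xs = _ ∷ xs} {ys} (Dx ∷ Dxs) (Rx ∷ Rxs) = begin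
  suc (length xs)        ≤⟨ s≤s (length-≤-injection R-injective Dxs
                                  (All.zipWith (λ (Dxx′ , Rx′) → Any-─ Rx (R-injective Dxx′) Rx′)
                                               (Dx , Rxs))) ⟩
  suc (length (ys ─ Rx)) ≡⟨ length-removeAt′ ys (Any.index Rx) ⟨
  length ys              ∎
  where open ≤-Reasoning

Any⇒0<length : {P : A → Set} {xs : List A} → Any P xs → 0 < length xs
Any⇒0<length (here _)  = z<s
Any⇒0<length (there _) = z<s

length-filter-partition : (p : A → Bool) (xs : List A) →
  length xs ≡ length (filterᵇ p xs) + length (filterᵇ (not ∘ p) xs)
length-filter-partition p []       = refl
length-filter-partition p (x ∷ xs) with p x
... | true  = cong suc (length-filter-partition p xs)
... | false = trans (cong suc (length-filter-partition p xs)) (sym (+-suc _ _))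

length-concatMap : (g : A → List B) (k : ℕ) → (∀ x → length (g x) ≡ k) →
  (xs : List A) → length (concatMap g xs) ≡ length xs * k
length-concatMap g k g-length []       = refl
length-concatMap g k g-length (x ∷ xs) =
  trans (length-++ (g x)) (cong₂ _+_ (g-length x) (length-concatMap g k g-length xs))

T-not : ∀ {b} → T (not b) ⇔ (¬ T b)
T-not {true}  = mk⇔ (λ ()) (λ ¬t → ¬t tt)
T-not {false} = mk⇔ (λ _ ()) (λ _ → tt)

T-implies : ∀ {a b} → T (not a ∨ b) ⇔ (T a → T b)
T-implies {true}  = mk⇔ (λ tb _ → tb) (λ f → f tt)
T-implies {false} = mk⇔ (λ _ ()) (λ _ → tt)

T-injective : ∀ {a b} → T a ⇔ T b → a ≡ b
T-injective {true}  {true}  _   = refl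
T-injective {true}  {false} a⇔b = ⊥-elim (Equivalence.to a⇔b tt)
T-injective {false} {true}  a⇔b = ⊥-elim (Equivalence.from a⇔b tt)
T-injective {false} {false} _   = refl

allᵇ≡all : (p : A → Bool) (xs : List A) → allᵇ p xs ≡ all p xs
allᵇ≡all p []       = refl
allᵇ≡all p (x ∷ xs) = cong (p x ∧_) (allᵇ≡all p xs)

T-allᵇ : (p : A → Bool) (xs : List A) → T (allᵇ p xs) ⇔ All (T ∘ p) xs
T-allᵇ p xs rewrite allᵇ≡all p xs = mk⇔ (Allₚ.all⁺ p xs) (Allₚ.all⁻ p)

-- Enumerations of functions up to pointwise equality

record Enumerates {A B : Set} (P : (A → B) → Set) (fs : List (A → B)) : Set where
  field
    sound    : All P fs
    complete : ∀ {f} → P f → Any (_≗ f) fs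
    distinct : AllPairs (λ f g → ¬ f ≗ g) fs
open Enumerates

module _ {A B : Set} {P Q : (A → B) → Set} {fs : List (A → B)} where

  enumerates-⇔ : (∀ {f} → P f ⇔ Q f) → Enumerates P fs → Enumerates Q fs
  enumerates-⇔ P⇔Q E = record
    { sound    = All.map (Equivalence.to P⇔Q) (sound E)
    ; complete = λ Qf → complete E (Equivalence.from P⇔Q Qf)
    ; distinct = distinct E
    }

module _ {A B : Set} {P : (A → B) → Set} {fs : List (A → B)} where

  filter-enumerates : (p : (A → B) → Bool) → (∀ {f g} → f ≗ g → p f ≡ p g) →
    Enumerates P fs → Enumerates (λ f → P f × T (p f)) (filterᵇ p fs)
  filter-enumerates p p-cong E = record
    { sound    = All.zip (Allₚ.filter⁺ (T? ∘ p) (sound E) , Allₚ.all-filter (T? ∘ p) fs)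
    ; complete = λ (Pf , pf) → retained (complete E Pf) pf
    ; distinct = AllPairsₚ.filter⁺ (T? ∘ p) (distinct E)
    }
    where
    retained : ∀ {f} (f∈fs : Any (_≗ f) fs) → T (p f) → Any (_≗ f) (filterᵇ p fs)
    retained f∈fs pf =
      [ id , (λ ¬pg → contradiction (subst T (sym (p-cong (Anyₚ.lookup-result f∈fs))) pf) ¬pg) ]′
        (Anyₚ.filter⁺ (T? ∘ p) f∈fs)

  enumerates-positive : Enumerates P fs → ∀ {f} → P f → 0 < length fs
  enumerates-positive E Pf = Any⇒0<length (complete E Pf)


enumerates-witness : {P : (A → B) → Set} {fs : List (A → B)} →
  Enumerates P fs → 0 < length fs → ∃ P
enumerates-witness {fs = f ∷ _} E _ = f , All.head (sound E)

enumerates-≤ : {A B A′ B′ : Set} {P : (A → B) → Set} {Q : (A′ → B′) → Set}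
  {fs : List (A → B)} {gs : List (A′ → B′)} →
  Enumerates P fs → Enumerates Q gs →
  (φ : (A → B) → (A′ → B′)) → (∀ {f} → P f → Q (φ f)) →
  (∀ {f g} → P f → P g → φ f ≗ φ g → f ≗ g) → length fs ≤ length gs
enumerates-≤ {P = P} Efs Egs φ φ-maps φ-injective =
  length-≤-injection {R = λ f g → P f × g ≗ φ f}
    (λ f≉f′ (Pf , g≗φf) (Pf′ , g≗φf′) →
       f≉f′ (φ-injective Pf Pf′ (λ x → trans (sym (g≗φf x)) (g≗φf′ x))))
    (distinct Efs)
    (All.map (λ Pf → Any.map (Pf ,_) (complete Egs (φ-maps Pf))) (sound Efs))

allFuns-enumerates : ∀ m n → Enumerates (λ _ → ⊤) (allFuns m n)
allFuns-enumerates m n = record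
  { sound    = All.universal (λ _ → tt) _
  ; complete = λ {f} _ → complete′ m f
  ; distinct = distinct′ m
  }
  where
  extend-≗ : ∀ {m} {f : Fin (suc m) → Fin n} {g j} → g ≗ f ∘ suc → j ≡ f zero → extend j g ≗ f
  extend-≗ g≗f∘suc refl zero    = refl
  extend-≗ g≗f∘suc refl (suc i) = g≗f∘suc i

  complete′ : ∀ m (f : Fin m → Fin n) → Any (_≗ f) (allFuns m n)
  complete′ zero    f = here (λ ())
  complete′ (suc m) f = Anyₚ.concat⁺ (Anyₚ.map⁺ (Any.map
    (λ g≗f∘suc → Anyₚ.map⁺ (Any.map (λ j≡f0 → extend-≗ g≗f∘suc (sym j≡f0))
                                    (∈-allFin (f zero))))
    (complete′ m (f ∘ suc))))

  distinct′ : ∀ m → AllPairs (λ f g → ¬ f ≗ g) (allFuns m n)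
  distinct′ zero    = [] ∷ []
  distinct′ (suc m) = AllPairsₚ.concat⁺
    (Allₚ.map⁺ (All.universal
      (λ g → AllPairsₚ.map⁺ (AllPairsₚ.tabulate⁺ (λ i≢j e → i≢j (e zero)))) _))
    (AllPairsₚ.map⁺ (AllPairs.map
      (λ g≉g′ → Allₚ.map⁺ (Allₚ.tabulate⁺ λ _ →
                  Allₚ.map⁺ (Allₚ.tabulate⁺ λ _ e → g≉g′ (e ∘ suc))))
      (distinct′ m)))

allFuns-length : ∀ m n → length (allFuns m n) ≡ n ^ m
allFuns-length zero    n = refl
allFuns-length (suc m) n = begin
  length (allFuns (suc m) n) ≡⟨ length-concatMap _ n (λ _ → trans (length-map _ (allFin n)) (length-tabulate id))
                                                   (allFuns m n) ⟩
  length (allFuns m n) * n   ≡⟨ cong (_* n) (allFuns-length m n) ⟩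
  n ^ m * n                  ≡⟨ *-comm (n ^ m) n ⟩
  n ^ suc m                  ∎
  where open ≡-Reasoning

functions : (m : ℕ) → List A → List (Fin m → A)
functions zero    xs = (λ ()) ∷ []
functions (suc m) xs = concatMap (λ f → map (_◂ f) xs) (functions m xs)

functions-complete : (_≈_ : A → A → Set) {xs : List A} → (∀ x → Any (_≈ x) xs) →
  ∀ m (f : Fin m → A) → Any (λ g → ∀ i → g i ≈ f i) (functions m xs)
functions-complete _≈_ xs-complete zero    f = here (λ ())
functions-complete _≈_ xs-complete (suc m) f = Anyₚ.concat⁺ (Anyₚ.map⁺ (Any.map
  (λ g≈f∘suc → Anyₚ.map⁺ (Any.map (λ x≈f0 → λ { zero → x≈f0 ; (suc i) → g≈f∘suc i })
                                  (xs-complete (f zero))))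
  (functions-complete _≈_ xs-complete m (f ∘ suc))))

IsHom : (G F : Graph) → (Fin (order G) → Fin (order F)) → Set
IsHom G F f = ∀ u v → T (adj G u v) → T (adj F (f u) (f v))

IsHom-≗ : (G F : Graph) {f g : Fin (order G) → Fin (order F)} → f ≗ g → IsHom G F f → IsHom G F g
IsHom-≗ G F f≗g f-hom u v uv = subst₂ (λ a b → T (adj F a b)) (f≗g u) (f≗g v) (f-hom u v uv)

T-isHom : (G F : Graph) (f : Fin (order G) → Fin (order F)) → T (isHom G F f) ⇔ IsHom G F f
T-isHom G F f = mk⇔ to from
  where
  to : T (isHom G F f) → IsHom G F f
  to h u v = Equivalence.to T-implies
    (All.lookup (Equivalence.to (T-allᵇ _ _) (All.lookup (Equivalence.to (T-allᵇ _ _) h) (∈-allFin u)))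
                (∈-allFin v))
  from : IsHom G F f → T (isHom G F f)
  from h = Equivalence.from (T-allᵇ _ _) (Allₚ.tabulate⁺ λ u →
             Equivalence.from (T-allᵇ _ _) (Allₚ.tabulate⁺ λ v → Equivalence.from T-implies (h u v)))

isHom-cong : (G F : Graph) {f g : Fin (order G) → Fin (order F)} → f ≗ g → isHom G F f ≡ isHom G F g
isHom-cong G F f≗g = T-injective (mk⇔ (transport f≗g) (transport (sym ∘ f≗g)))
  where
  transport : ∀ {f g} → f ≗ g → T (isHom G F f) → T (isHom G F g)
  transport f≗g = Equivalence.from (T-isHom G F _) ∘ IsHom-≗ G F f≗g ∘ Equivalence.to (T-isHom G F _)

homs : (G F : Graph) → List (Fin (order G) → Fin (order F))
homs G F = filterᵇ (isHom G F) (allFuns (order G) (order F))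

homs-enumerates : (G F : Graph) → Enumerates (IsHom G F) (homs G F)
homs-enumerates G F = enumerates-⇔
  (mk⇔ (λ (_ , h) → Equivalence.to (T-isHom G F _) h) (λ h → tt , Equivalence.from (T-isHom G F _) h))
  (filter-enumerates (isHom G F) (isHom-cong G F) (allFuns-enumerates (order G) (order F)))

hom-≤ : (G F : Graph) → hom G F ≤ order F ^ order G
hom-≤ G F = ≤-trans (length-filter (T? ∘ isHom G F) (allFuns (order G) (order F)))
                    (≤-reflexive (allFuns-length (order G) (order F)))

hom-adj-cong : (G F : Graph) (A : Fin (order F) → Fin (order F) → Bool)
  (A-sym : ∀ u v → A u v ≡ A v u) (A-irrefl : ∀ u → A u u ≡ false) →
  (∀ u v → A u v ≡ adj F u v) →
  hom G (record F { adj = A ; adj-sym = A-sym ; adj-irrefl = A-irrefl }) ≡ hom G F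
hom-adj-cong G F A A-sym A-irrefl A≡adj =
  cong length (filter-≐ (T? ∘ isHom G F′) (T? ∘ isHom G F) (F′→F , F→F′)
                        (allFuns (order G) (order F)))
  where
  F′ : Graph
  F′ = record F { adj = A ; adj-sym = A-sym ; adj-irrefl = A-irrefl }
  F′→F : ∀ {f} → T (isHom G F′ f) → T (isHom G F f)
  F′→F h = Equivalence.from (T-isHom G F _) (λ u v uv →
    subst T (A≡adj _ _) (Equivalence.to (T-isHom G F′ _) h u v uv))
  F→F′ : ∀ {f} → T (isHom G F f) → T (isHom G F′ f)
  F→F′ h = Equivalence.from (T-isHom G F′ _) (λ u v uv →
    subst T (sym (A≡adj _ _)) (Equivalence.to (T-isHom G F _) h u v uv))

adj⇒≢ : (G : Graph) {u v : Fin (order G)} → T (adj G u v) → u ≢ v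
adj⇒≢ G {u} uv refl = subst T (adj-irrefl G u) uv

-- Graphs given by adjacency matrices

Matrix : ℕ → Set
Matrix n = Fin n → Fin n → Bool

symmetrize : Matrix n → Matrix n
symmetrize M u v = M u v ∧ M v u ∧ not ⌊ u ≟ v ⌋

T-not-⌊≟⌋ : (u v : Fin n) → T (not ⌊ u ≟ v ⌋) ⇔ u ≢ v
T-not-⌊≟⌋ u v with u ≟ v
... | yes u≡v = mk⇔ (λ ()) (λ u≢v → u≢v u≡v)
... | no  u≢v = mk⇔ (λ _ → u≢v) (λ _ → tt)

⌊≟⌋-sym : (u v : Fin n) → ⌊ u ≟ v ⌋ ≡ ⌊ v ≟ u ⌋
⌊≟⌋-sym u v with u ≟ v | v ≟ u
... | yes _   | yes _   = refl
... | no  _   | no  _   = refl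
... | yes u≡v | no  v≢u = contradiction (sym u≡v) v≢u
... | no  u≢v | yes v≡u = contradiction (sym v≡u) u≢v

⌊≟⌋-refl : (u : Fin n) → ⌊ u ≟ u ⌋ ≡ true
⌊≟⌋-refl u with u ≟ u
... | yes _   = refl
... | no  u≢u = contradiction refl u≢u

symmetrize-sym : (M : Matrix n) (u v : Fin n) → symmetrize M u v ≡ symmetrize M v u
symmetrize-sym M u v rewrite ⌊≟⌋-sym u v with M u v | M v u
... | true  | true  = refl
... | true  | false = refl
... | false | true  = refl
... | false | false = refl

symmetrize-irrefl : (M : Matrix n) (u : Fin n) → symmetrize M u u ≡ false
symmetrize-irrefl M u rewrite ⌊≟⌋-refl u with M u u
... | true  = refl
... | false = refl

symmetrize-adj : (X : Graph) (u v : Fin (order X)) → symmetrize (adj X) u v ≡ adj X u v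
symmetrize-adj X u v with u ≟ v
... | yes refl rewrite adj-irrefl X u = refl
... | no  _    rewrite adj-sym X v u with adj X u v
...   | true  = refl
...   | false = refl

graphOf : (n : ℕ) .⦃ _ : NonZero n ⦄ → Matrix n → Graph
graphOf n M = record
  { order      = n
  ; nonempty   = >-nonZero⁻¹ n
  ; adj        = symmetrize M
  ; adj-sym    = symmetrize-sym M
  ; adj-irrefl = symmetrize-irrefl M
  }

K : (n : ℕ) .⦃ _ : NonZero n ⦄ → Graph
K n = graphOf n (λ _ _ → true)

matrices : (n : ℕ) → List (Matrix n)
matrices n = functions n (functions n (true ∷ false ∷ []))

matrices-complete : (A : Matrix n) → Any (λ M → ∀ u v → M u v ≡ A u v) (matrices n)
matrices-complete {n} = functions-complete _≗_ (functions-complete _≡_ bool-complete n) n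
  where
  bool-complete : ∀ b → Any (_≡ b) (true ∷ false ∷ [])
  bool-complete true  = here refl
  bool-complete false = there (here refl)

testGraphs : ℕ → List Graph
testGraphs B = concatMap (λ n → map (graphOf (suc n)) (matrices (suc n))) (upTo B)

testGraphs-complete : (B : ℕ) (X : Graph) → order X ≤ B →
  Any (λ Y → ∀ G → hom G Y ≡ hom G X) (testGraphs B)
testGraphs-complete B X@record { order = suc n } X≤B =
  Anyₚ.concat⁺ (Anyₚ.map⁺ (Any.map
    (λ { refl → Anyₚ.map⁺ (Any.map same-homs (matrices-complete (adj X))) })
    (∈-upTo⁺ X≤B)))
  where
  -- graphOf (suc n) M and X differ only in nonempty, which hom ignores
  same-homs : ∀ {M} → (∀ u v → M u v ≡ adj X u v) → ∀ G → hom G (graphOf (suc n) M) ≡ hom G X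
  same-homs {M} M≡adj G = hom-adj-cong G X (symmetrize M) (symmetrize-sym M) (symmetrize-irrefl M) λ u v →
    trans (cong₂ (λ a b → a ∧ b ∧ not ⌊ u ≟ v ⌋) (M≡adj u v) (M≡adj v u)) (symmetrize-adj X u v)

-- Colourings and the order of a graph

colourable : (G : Graph) (n : ℕ) .⦃ _ : NonZero n ⦄ → order G ≤ n → 0 < hom G (K n)
colourable G n G≤n = enumerates-positive (homs-enumerates G (K n)) inject-hom
  where
  inject-hom : IsHom G (K n) (λ u → inject≤ u G≤n)
  inject-hom u v uv = Equivalence.from (T-not-⌊≟⌋ _ _)
    (adj⇒≢ G uv ∘ inject≤-injective G≤n G≤n u v)

module Recolouring (H : Graph) {n : ℕ} .⦃ _ : NonZero n ⦄
                   (c : Fin (order H) → Fin n) (c-hom : IsHom H (K n) c) where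

  recolour : Fin (order H) → Fin (order H) → Fin (suc n)
  recolour v u with u ≟ v
  ... | yes _ = fromℕ n
  ... | no  _ = inject₁ (c u)

  recolour-hom : ∀ v → IsHom H (K (suc n)) (recolour v)
  recolour-hom v u w uw = Equivalence.from (T-not-⌊≟⌋ _ _) (distinct-colours u w uw)
    where
    distinct-colours : ∀ u w → T (adj H u w) → recolour v u ≢ recolour v w
    distinct-colours u w uw with u ≟ v | w ≟ v
    ... | yes refl | yes refl = λ _ → adj⇒≢ H uw refl
    ... | yes _    | no  _    = fromℕ≢inject₁
    ... | no  _    | yes _    = fromℕ≢inject₁ ∘ sym
    ... | no  _    | no  _    =
      Equivalence.to (T-not-⌊≟⌋ _ _) (c-hom u w uw) ∘ inject₁-injective

  recolour-injective : ∀ {v w} → recolour v v ≡ recolour w v → v ≡ w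
  recolour-injective {v} {w} e with v ≟ v | v ≟ w
  ... | _        | yes v≡w = v≡w
  ... | yes _    | no  _   = contradiction e fromℕ≢inject₁
  ... | no  v≢v  | no  _   = contradiction refl v≢v

  order≤hom : order H ≤ hom H (K (suc n))
  order≤hom = begin
    order H                   ≡⟨ length-tabulate id ⟨
    length (allFin (order H)) ≤⟨ length-≤-injection {R = λ v g → g ≗ recolour v}
                                   (λ {v} v≢w g≗v g≗w →
                                      v≢w (recolour-injective (trans (sym (g≗v v)) (g≗w v))))
                                   (Uniqueₚ.allFin⁺ (order H))
                                   (Allₚ.tabulate⁺ λ v →
                                      complete (homs-enumerates H (K (suc n))) (recolour-hom v)) ⟩
    hom H (K (suc n))         ∎
    where open ≤-Reasoning

order-bound : (G H : Graph) (n : ℕ) .⦃ _ : NonZero n ⦄ → order G ≤ n →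
  hom G (K n) ≡ hom H (K n) → hom G (K (suc n)) ≡ hom H (K (suc n)) → order H ≤ suc n ^ n
order-bound G H n G≤n Kₙ-agree Kₙ₊₁-agree with
  enumerates-witness (homs-enumerates H (K n)) (subst (0 <_) Kₙ-agree (colourable G n G≤n))
... | c , c-hom = begin
  order H            ≤⟨ Recolouring.order≤hom H c c-hom ⟩
  hom H (K (suc n))  ≡⟨ Kₙ₊₁-agree ⟨
  hom G (K (suc n))  ≤⟨ hom-≤ G (K (suc n)) ⟩
  suc n ^ order G    ≤⟨ ^-monoʳ-≤ (suc n) G≤n ⟩
  suc n ^ n          ∎
  where open ≤-Reasoning

-- Counting homomorphisms that hit prescribed vertices

hit : Fin n → (Fin m → Fin n) → Bool
hit t f = any (λ x → ⌊ f x ≟ t ⌋) (allFin _)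

T-hit : (t : Fin n) (f : Fin m → Fin n) → T (hit t f) ⇔ (∃ λ x → f x ≡ t)
T-hit t f = mk⇔ to from
  where
  to : T (hit t f) → ∃ λ x → f x ≡ t
  to h = Product.map₂ toWitness (Any.satisfied (Anyₚ.any⁻ _ (allFin _) h))
  from : (∃ λ x → f x ≡ t) → T (hit t f)
  from (x , fx≡t) = Anyₚ.any⁺ _ (Any.map (λ { refl → fromWitness fx≡t }) (∈-allFin x))

hit-cong : (t : Fin n) {f g : Fin m → Fin n} → f ≗ g → hit t f ≡ hit t g
hit-cong t f≗g = cong or (map-cong (λ x → cong (λ y → ⌊ y ≟ t ⌋) (f≗g x)) (allFin _))

Hits : List (Fin n) → (Fin m → Fin n) → Set
Hits ts f = All (λ t → ∃ λ x → f x ≡ t) ts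

homsHitting : (G F : Graph) (ι : Fin (order F) → Fin n) → List (Fin n) →
  List (Fin (order G) → Fin (order F))
homsHitting G F ι []      = homs G F
homsHitting G F ι (t ∷ ts) = filterᵇ (λ g → hit t (ι ∘ g)) (homsHitting G F ι ts)

homsHitting-enumerates : (G F : Graph) (ι : Fin (order F) → Fin n) (ts : List (Fin n)) →
  Enumerates (λ g → IsHom G F g × Hits ts (ι ∘ g)) (homsHitting G F ι ts)
homsHitting-enumerates G F ι [] = enumerates-⇔ (mk⇔ (_, []) proj₁) (homs-enumerates G F)
homsHitting-enumerates G F ι (t ∷ ts) = enumerates-⇔
  (mk⇔ (λ ((h , hs) , ht) → h , Equivalence.to (T-hit _ _) ht ∷ hs)
       (λ { (h , ht ∷ hs) → (h , hs) , Equivalence.from (T-hit _ _) ht }))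
  (filter-enumerates _ (λ g≗g′ → hit-cong t (cong ι ∘ g≗g′)) (homsHitting-enumerates G F ι ts))

avoiding : (G F : Graph) (ι : Fin (order F) → Fin n) → Fin n → List (Fin n) →
  List (Fin (order G) → Fin (order F))
avoiding G F ι t ts = filterᵇ (λ g → not (hit t (ι ∘ g))) (homsHitting G F ι ts)

avoiding-enumerates : (G F : Graph) (ι : Fin (order F) → Fin n) → Injective _≡_ _≡_ ι →
  (w : Fin (order F)) (ts : List (Fin n)) →
  Enumerates (λ g → (IsHom G F g × Hits ts (ι ∘ g)) × (∀ x → g x ≢ w)) (avoiding G F ι (ι w) ts)
avoiding-enumerates G F ι ι-injective w ts = enumerates-⇔
  (mk⇔ (Product.map₂ λ ¬hit x gx≡w →
          Equivalence.to T-not ¬hit (Equivalence.from (T-hit _ _) (x , cong ι gx≡w)))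
       (Product.map₂ λ avoids → Equivalence.from T-not λ h →
          let x , ιgx≡ιw = Equivalence.to (T-hit _ _) h in avoids x (ι-injective ιgx≡ιw)))
  (filter-enumerates _ (λ g≗g′ → cong not (hit-cong (ι w) (cong ι ∘ g≗g′)))
                     (homsHitting-enumerates G F ι ts))

avoiding-outside : (G F : Graph) (ι : Fin (order F) → Fin n) (t : Fin n) → (∀ w → ι w ≢ t) →
  (ts : List (Fin n)) → avoiding G F ι t ts ≡ homsHitting G F ι ts
avoiding-outside G F ι t t∉ι ts =
  filter-all (T? ∘ λ g → not (hit t (ι ∘ g))) (All.universal (λ g → Equivalence.from T-not λ h →
    let x , ιgx≡t = Equivalence.to (T-hit t (ι ∘ g)) h in t∉ι (g x) ιgx≡t) _)

≤1⇒Fin-trivial : n ≤ 1 → (a b : Fin n) → a ≡ b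
≤1⇒Fin-trivial (s≤s z≤n) zero zero = refl

vertex : (X : Graph) → Fin (order X)
vertex X = fromℕ< (nonempty X)

avoiding-single : (G F : Graph) (ι : Fin (order F) → Fin n) → order F ≤ 1 →
  (w : Fin (order F)) (ts : List (Fin n)) → avoiding G F ι (ι w) ts ≡ []
avoiding-single G F ι F≤1 w ts =
  filter-none (T? ∘ λ g → not (hit (ι w) (ι ∘ g))) {homsHitting G F ι ts} (All.universal (λ g ¬hit →
    Equivalence.to T-not ¬hit
      (Equivalence.from (T-hit (ι w) (ι ∘ g)) (vertex G , cong ι (≤1⇒Fin-trivial F≤1 _ _)))) _)

record VertexDeletion (F : Graph) (w : Fin (order F)) : Set where
  field
    graph           : Graph
    embed           : Fin (order graph) → Fin (order F)
    retract         : Fin (order F) → Fin (order graph)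
    embed-injective : Injective _≡_ _≡_ embed
    embed-avoids    : ∀ a → embed a ≢ w
    embed-retract   : ∀ u → u ≢ w → embed (retract u) ≡ u
    adj-embed       : ∀ a b → adj graph a b ≡ adj F (embed a) (embed b)

deleteVertex : (F : Graph) → 2 ≤ order F → (w : Fin (order F)) → VertexDeletion F w
deleteVertex record { order = suc (suc k) ; adj = A ; adj-sym = A-sym ; adj-irrefl = A-irrefl } _ w = record
  { graph           = record
      { order      = suc k
      ; nonempty   = s≤s z≤n
      ; adj        = λ a b → A (punchIn w a) (punchIn w b)
      ; adj-sym    = λ a b → A-sym _ _
      ; adj-irrefl = λ a → A-irrefl _
      }
  ; embed           = punchIn w
  ; retract         = retract
  ; embed-injective = punchIn-injective w _ _
  ; embed-avoids    = punchInᵢ≢i w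
  ; embed-retract   = embed-retract
  ; adj-embed       = λ _ _ → refl
  }
  where
  -- junk value zero at u = w, where there is nothing to retract to
  retract : Fin (suc (suc k)) → Fin (suc k)
  retract u with u ≟ w
  ... | yes _   = zero
  ... | no  u≢w = punchOut (u≢w ∘ sym)

  embed-retract : ∀ u → u ≢ w → punchIn w (retract u) ≡ u
  embed-retract u u≢w with u ≟ w
  ... | yes u≡w = contradiction u≡w u≢w
  ... | no  _   = punchIn-punchOut _
deleteVertex record { order = suc zero } (s≤s ()) _

module _ (G F : Graph) {w : Fin (order F)} (D : VertexDeletion F w)
         (ι : Fin (order F) → Fin n) (ι-injective : Injective _≡_ _≡_ ι) (ts : List (Fin n)) where

  open VertexDeletion D

  avoiding≡homsHitting-deleted :
    length (avoiding G F ι (ι w) ts) ≡ length (homsHitting G graph (ι ∘ embed) ts)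
  avoiding≡homsHitting-deleted = ≤-antisym
    (enumerates-≤ avoiding-enum deleted-enum (retract ∘_) retract-maps retract-injective)
    (enumerates-≤ deleted-enum avoiding-enum (embed ∘_) embed-maps (λ _ _ e x → embed-injective (e x)))
    where
    avoiding-enum : Enumerates (λ g → (IsHom G F g × Hits ts (ι ∘ g)) × (∀ x → g x ≢ w))
                               (avoiding G F ι (ι w) ts)
    avoiding-enum = avoiding-enumerates G F ι ι-injective w ts
    deleted-enum : Enumerates (λ g → IsHom G graph g × Hits ts (ι ∘ embed ∘ g))
                              (homsHitting G graph (ι ∘ embed) ts)
    deleted-enum = homsHitting-enumerates G graph (ι ∘ embed) ts

    embed-hom : ∀ {g} → IsHom G graph g → IsHom G F (embed ∘ g)
    embed-hom g-hom u v uv = subst T (adj-embed _ _) (g-hom u v uv)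

    retract-hom : ∀ {g} → IsHom G F (embed ∘ retract ∘ g) → IsHom G graph (retract ∘ g)
    retract-hom h u v uv = subst T (sym (adj-embed _ _)) (h u v uv)

    embed-retract∘ : ∀ {g} → (∀ x → g x ≢ w) → embed ∘ retract ∘ g ≗ g
    embed-retract∘ avoids x = embed-retract _ (avoids x)

    retract-maps : ∀ {g} → (IsHom G F g × Hits ts (ι ∘ g)) × (∀ x → g x ≢ w) →
                   IsHom G graph (retract ∘ g) × Hits ts (ι ∘ embed ∘ retract ∘ g)
    retract-maps ((g-hom , g-hits) , avoids) =
        retract-hom (IsHom-≗ G F (sym ∘ embed-retract∘ avoids) g-hom)
      , All.map (Product.map₂ (trans (cong ι (embed-retract∘ avoids _)))) g-hits

    retract-injective : ∀ {g g′} → (IsHom G F g × Hits ts (ι ∘ g)) × (∀ x → g x ≢ w) →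
                        (IsHom G F g′ × Hits ts (ι ∘ g′)) × (∀ x → g′ x ≢ w) →
                        retract ∘ g ≗ retract ∘ g′ → g ≗ g′
    retract-injective {g} {g′} (_ , avoids) (_ , avoids′) e x = begin
      g x                     ≡⟨ embed-retract∘ avoids x ⟨
      embed (retract (g x))   ≡⟨ cong embed (e x) ⟩
      embed (retract (g′ x))  ≡⟨ embed-retract∘ avoids′ x ⟩
      g′ x                    ∎
      where open ≡-Reasoning

    embed-maps : ∀ {g} → IsHom G graph g × Hits ts (ι ∘ embed ∘ g) →
                 (IsHom G F (embed ∘ g) × Hits ts (ι ∘ embed ∘ g)) × (∀ x → embed (g x) ≢ w)
    embed-maps {g} (g-hom , g-hits) = (embed-hom g-hom , g-hits) , λ x → embed-avoids (g x)

Agree : ℕ → Graph → Graph → Set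
Agree B G H = ∀ F → order F ≤ B → hom G F ≡ hom H F

-- Homomorphisms hitting t ∷ ts are those hitting ts minus those avoiding t, and for
-- t = ι w those avoiding t are the homomorphisms into F − w.  The prescribed vertices
-- live in a fixed Fin n into which ι places the vertices of F, so ts does not change
-- when a vertex is deleted and induction on ts suffices.
module _ {B : ℕ} {G H : Graph} (agree : Agree B G H) where

  HittingAgrees : List (Fin n) → Set
  HittingAgrees {n} ts =
    ∀ F → order F ≤ B → (ι : Fin (order F) → Fin n) → Injective _≡_ _≡_ ι →
    length (homsHitting G F ι ts) ≡ length (homsHitting H F ι ts)

  avoiding-agrees : (ts : List (Fin n)) → HittingAgrees ts →
    ∀ F → order F ≤ B → (ι : Fin (order F) → Fin n) → Injective _≡_ _≡_ ι → (t : Fin n) →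
    length (avoiding G F ι t ts) ≡ length (avoiding H F ι t ts)
  avoiding-agrees ts IH F F≤B ι ι-injective t with any? (λ w → ι w ≟ t)
  ... | no t∉ι rewrite avoiding-outside G F ι t (λ w → t∉ι ∘ (w ,_)) ts
                     | avoiding-outside H F ι t (λ w → t∉ι ∘ (w ,_)) ts = IH F F≤B ι ι-injective
  ... | yes (w , refl) with 2 ≤? order F
  ...   | no 2≰F rewrite avoiding-single G F ι (s≤s⁻¹ (≰⇒> 2≰F)) w ts
                       | avoiding-single H F ι (s≤s⁻¹ (≰⇒> 2≰F)) w ts = refl
  ...   | yes 2≤F = begin
    length (avoiding G F ι (ι w) ts)            ≡⟨ avoiding≡homsHitting-deleted G F D ι ι-injective ts ⟩
    length (homsHitting G graph (ι ∘ embed) ts) ≡⟨ IH graph (≤-trans (injective⇒≤ embed-injective) F≤B)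
                                                     (ι ∘ embed) (embed-injective ∘ ι-injective) ⟩
    length (homsHitting H graph (ι ∘ embed) ts) ≡⟨ avoiding≡homsHitting-deleted H F D ι ι-injective ts ⟨
    length (avoiding H F ι (ι w) ts)            ∎
    where
    D : VertexDeletion F w
    D = deleteVertex F 2≤F w
    open VertexDeletion D
    open ≡-Reasoning

  hitting-agrees : (ts : List (Fin n)) → HittingAgrees ts
  hitting-agrees []      F F≤B ι ι-injective = agree F F≤B
  hitting-agrees (t ∷ ts) F F≤B ι ι-injective = +-cancelʳ-≡ _ _ _ (begin
    length (homsHitting G F ι (t ∷ ts)) + length (avoiding G F ι t ts) ≡⟨ split G ⟨
    length (homsHitting G F ι ts)                                      ≡⟨ hitting-agrees ts F F≤B ι ι-injective ⟩
    length (homsHitting H F ι ts)                                      ≡⟨ split H ⟩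
    length (homsHitting H F ι (t ∷ ts)) + length (avoiding H F ι t ts) ≡⟨ cong (_ +_) avoiding-agree ⟨
    length (homsHitting H F ι (t ∷ ts)) + length (avoiding G F ι t ts) ∎)
    where
    open ≡-Reasoning
    split : ∀ X → length (homsHitting X F ι ts) ≡
                  length (homsHitting X F ι (t ∷ ts)) + length (avoiding X F ι t ts)
    split X = length-filter-partition (λ g → hit t (ι ∘ g)) (homsHitting X F ι ts)
    avoiding-agree : length (avoiding G F ι t ts) ≡ length (avoiding H F ι t ts)
    avoiding-agree = avoiding-agrees ts (hitting-agrees ts) F F≤B ι ι-injective t

-- Surjective homomorphisms in both directions

Onto : (Fin m → Fin n) → Set
Onto f = ∀ t → ∃ λ x → f x ≡ t

onto⇒≥ : (f : Fin m → Fin n) → Onto f → n ≤ m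
onto⇒≥ f f-onto = injective⇒≤ {f = proj₁ ∘ f-onto} λ {s} {t} e →
  trans (sym (proj₂ (f-onto s))) (trans (cong f e) (proj₂ (f-onto t)))

onto⇒injective : (f : Fin m → Fin n) → Onto f → m ≤ n → Injective _≡_ _≡_ f
onto⇒injective {suc m} f f-onto m≤n {x} {y} fx≡fy with x ≟ y
... | yes x≡y = x≡y
... | no  x≢y = contradiction (onto⇒≥ (f ∘ punchIn y) onto-without-y) (<⇒≱ m≤n)
  where
  onto-without-y : Onto (f ∘ punchIn y)
  onto-without-y t with f-onto t
  ... | z , fz≡t with z ≟ y
  ...   | yes refl = punchOut (x≢y ∘ sym) , trans (cong f (punchIn-punchOut _)) (trans fx≡fy fz≡t)
  ...   | no  z≢y  = punchOut (z≢y ∘ sym) , trans (cong f (punchIn-punchOut _)) fz≡t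

surjections : (G F : Graph) → List (Fin (order G) → Fin (order F))
surjections G F = homsHitting G F id (allFin (order F))

surjections-enumerates : (G F : Graph) → Enumerates (λ f → IsHom G F f × Onto f) (surjections G F)
surjections-enumerates G F = enumerates-⇔
  (mk⇔ (Product.map₂ λ hits t → All.lookup hits (∈-allFin t)) (Product.map₂ Allₚ.tabulate⁺))
  (homsHitting-enumerates G F id (allFin (order F)))

identity-surjection : (G : Graph) → 0 < length (surjections G G)
identity-surjection G = enumerates-positive (surjections-enumerates G G) ((λ _ _ uv → uv) , (λ t → t , refl))

vertexPairs : (X : Graph) → List (Fin (order X) × Fin (order X))
vertexPairs X = cartesianProduct (allFin (order X)) (allFin (order X))

edges : (X : Graph) → List (Fin (order X) × Fin (order X))
edges X = filterᵇ (λ (u , v) → adj X u v) (vertexPairs X)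

edges-unique : (X : Graph) → Unique (edges X)
edges-unique X =
  AllPairsₚ.filter⁺ _ (Uniqueₚ.cartesianProduct⁺ (Uniqueₚ.allFin⁺ _) (Uniqueₚ.allFin⁺ _))

edges-adjacent : (X : Graph) → All (λ (u , v) → T (adj X u v)) (edges X)
edges-adjacent X = Allₚ.all-filter (T? ∘ λ (u , v) → adj X u v) (vertexPairs X)

∈-edges : (X : Graph) {u v : Fin (order X)} → T (adj X u v) → (u , v) ∈ edges X
∈-edges X uv = ∈-filter⁺ _ (∈-cartesianProduct⁺ (∈-allFin _) (∈-allFin _)) uv

edges-≥ : (G H : Graph) (σ : Fin (order G) → Fin (order H)) → Injective _≡_ _≡_ σ →
  (es : List (Fin (order G) × Fin (order G))) → Unique es →
  All (λ (u , v) → T (adj H (σ u) (σ v))) es → length es ≤ length (edges H)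
edges-≥ G H σ σ-injective es es-unique es-mapped = length-≤-injection
  {R = λ e e′ → Product.map σ σ e ≡ e′}
  (λ e≢e′ σe≡y σe′≡y → let σe≡σe′ = trans σe≡y (sym σe′≡y) in
     e≢e′ (cong₂ _,_ (σ-injective (cong proj₁ σe≡σe′)) (σ-injective (cong proj₂ σe≡σe′))))
  es-unique
  (All.map (∈-edges H) es-mapped)

onto-homs⇒≅ : (G H : Graph) (σ : Fin (order G) → Fin (order H)) (τ : Fin (order H) → Fin (order G)) →
  IsHom G H σ → Onto σ → IsHom H G τ → Onto τ → G ≅ H
onto-homs⇒≅ G H σ τ σ-hom σ-onto τ-hom τ-onto = record
  { to       = σ
  ; from     = proj₁ ∘ σ-onto
  ; from-to  = λ u → σ-injective (proj₂ (σ-onto (σ u)))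
  ; to-from  = proj₂ ∘ σ-onto
  ; adj-pres = λ u v → T-injective (mk⇔ (reflects u v) (σ-hom u v))
  }
  where
  σ-injective : Injective _≡_ _≡_ σ
  σ-injective = onto⇒injective σ σ-onto (onto⇒≥ τ τ-onto)
  τ-injective : Injective _≡_ _≡_ τ
  τ-injective = onto⇒injective τ τ-onto (onto⇒≥ σ σ-onto)

  |EH|≤|EG| : length (edges H) ≤ length (edges G)
  |EH|≤|EG| = edges-≥ H G τ τ-injective (edges H) (edges-unique H)
                (All.map (λ {(u , v)} → τ-hom u v) (edges-adjacent H))

  -- a non-edge of G mapped onto an edge of H would make H have more edges than G
  reflects : ∀ u v → T (adj H (σ u) (σ v)) → T (adj G u v)
  reflects u v σuσv with T? (adj G u v)
  ... | yes uv = uv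
  ... | no ¬uv = contradiction (≤-trans more-edges |EH|≤|EG|) (n≮n _)
    where
    more-edges : suc (length (edges G)) ≤ length (edges H)
    more-edges = edges-≥ G H σ σ-injective ((u , v) ∷ edges G)
      (All.map (λ e-adj uv≡e → ¬uv (subst (λ (a , b) → T (adj G a b)) (sym uv≡e) e-adj))
               (edges-adjacent G)
         ∷ edges-unique G)
      (σuσv ∷ All.map (λ {(a , b)} → σ-hom a b) (edges-adjacent G))

agree⇒≅ : (B : ℕ) (G H : Graph) → order G ≤ B → order H ≤ B → Agree B G H → G ≅ H
agree⇒≅ B G H G≤B H≤B agree =
  let σ , σ-hom , σ-onto = enumerates-witness (surjections-enumerates G H) some-G↠H
      τ , τ-hom , τ-onto = enumerates-witness (surjections-enumerates H G) some-H↠G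
  in onto-homs⇒≅ G H σ τ σ-hom σ-onto τ-hom τ-onto
  where
  some-G↠H : 0 < length (surjections G H)
  some-G↠H = subst (0 <_) (sym (hitting-agrees agree (allFin (order H)) H H≤B id id)) (identity-surjection H)
  some-H↠G : 0 < length (surjections H G)
  some-H↠G = subst (0 <_) (hitting-agrees agree (allFin (order G)) G G≤B id id) (identity-surjection G)

-- (s+1)^s bounds the order of H (order-bound), and s+1 covers K s and K (s+1)
orderBound : ℕ → ℕ
orderBound s = suc s ^ s + suc s

bounded-agree⇒≅ : (G H : Graph) (s : ℕ) .⦃ _ : NonZero s ⦄ →
  order G ≤ s → Agree (orderBound s) G H → G ≅ H
bounded-agree⇒≅ G H s G≤s agree = agree⇒≅ (orderBound s) G H G≤B H≤B agree
  where
  s+1≤B : suc s ≤ orderBound s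
  s+1≤B = m≤n+m (suc s) _
  G≤B : order G ≤ orderBound s
  G≤B = ≤-trans G≤s (≤-trans (n≤1+n s) s+1≤B)
  H≤B : order H ≤ orderBound s
  H≤B = ≤-trans (order-bound G H s G≤s (agree (K s) (≤-trans (n≤1+n s) s+1≤B))
                                        (agree (K (suc s)) s+1≤B))
                (m≤m+n _ _)

testGraphs-agree : (B : ℕ) (G H : Graph) →
  (∀ i → hom G (lookup (testGraphs B) i) ≡ hom H (lookup (testGraphs B) i)) → Agree B G H
testGraphs-agree B G H same F F≤B =
  trans (sym (same-homs G)) (trans (same (Any.index F∈tests)) (same-homs H))
  where
  F∈tests : Any (λ Y → ∀ X → hom X Y ≡ hom X F) (testGraphs B)
  F∈tests = testGraphs-complete B F F≤B
  same-homs : ∀ X → hom X (lookup (testGraphs B) (Any.index F∈tests)) ≡ hom X F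
  same-homs = Anyₚ.lookup-index F∈tests

≅⇒order≤ : {G H : Graph} → G ≅ H → order G ≤ order H
≅⇒order≤ G≅H = injective⇒≤ λ e → trans (sym (from-to _)) (trans (cong from e) (from-to _))
  where open _≅_ G≅H

order≤sum : {G : Graph} {Ls : List Graph} → Any (G ≅_) Ls → order G ≤ sum (map order Ls)
order≤sum (here G≅L)  = ≤-trans (≅⇒order≤ G≅L) (m≤m+n _ _)
order≤sum (there G∈Ls) = ≤-trans (order≤sum G∈Ls) (m≤n+m _ _)

corollary9p5 : (C : Graph → Set) → IsoClosed C → FinitelyManyUpToIso C → HasRightHomAlgorithm C
corollary9p5 C C-closed (Ls , Ls-covers) =
  length tests , nonempty-tests , lookup tests ,
  λ G H same → mk⇔ (transfer G H same) (transfer H G (sym ∘ same))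
  where
  s : ℕ
  s = suc (sum (map order Ls))
  tests : List Graph
  tests = testGraphs (orderBound s)

  nonempty-tests : 1 ≤ length tests
  nonempty-tests =
    Any⇒0<length (testGraphs-complete (orderBound s) (K 1) (≤-trans (s≤s z≤n) (m≤n+m (suc s) _)))

  transfer : ∀ G H → (∀ i → hom G (lookup tests i) ≡ hom H (lookup tests i)) → C G → C H
  transfer G H same G∈C = C-closed (bounded-agree⇒≅ G H s
    (≤-trans (order≤sum (Ls-covers G G∈C)) (n≤1+n _))
    (testGraphs-agree (orderBound s) G H same)) G∈C
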